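{- For every deterministic online algorithm $ALG$ for the online dominating set problem, $\rho(ALG, \Delta\text{ -BOUNDED}) = \Omega(\sqrt{\Delta})$.
   Context: Online dominating set model: an input is a finite, connected, simple, undirected graph $G=(V,E)$ together with an ordering $v_1,\dots,v_n$ of $V$ chosen by an adversary such that for every $i$ the subgraph induced on $\{v_1,\dots,v_i\}$ is connected. At step $i$, $v_i$ is revealed together with its entire closed neighbourhood $N[v_i]$ (including not yet revealed neighbours), and the algorithm irrevocably decides, before the next step, whether to select $v_i$; the selected set must be a dominating set of $G$. $ALG$ is the number of selected vertices, $OPT$ the minimum dominating set size; $\rho(ALG,\mathrm{CLASS})$ is the infimum of all $c$ with $\limsup_{OPT\to\infty} ALG/OPT\le c$ over inputs with graph in CLASS. For an integer $\Delta\ge2$ given to the algorithm beforehand, $\Delta$-BOUNDED is the class of graphs in which every vertex has degree at most $\Delta$. -}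

module Defs where

open import Data.Nat using (ℕ; zero; suc; _+_; _*_; _≤_; _<_)
open import Data.Bool using (Bool; true; false; if_then_else_)
open import Data.List using (List; []; _∷_; _++_; [_]; length; map; take)
open import Data.List.Membership.Propositional using (_∈_; _∉_)
open import Data.List.Relation.Unary.Unique.Propositional using (Unique)
open import Data.Product using (_×_; _,_; ∃-syntax)
open import Data.Sum using (_⊎_)
open import Relation.Binary.PropositionalEquality using (_≡_; _≢_)

-- Vertices carry arbitrary names (natural numbers), so that the names of
-- not-yet-revealed neighbours leak nothing about the revelation order.
-- A graph is given by its vertex list and an (open) neighbourhood function;
-- u and v are adjacent iff u ∈ nbr v.

-- Reach S nbr u w : there is a path from u to w in the subgraph induced on S
-- (u is assumed to lie in S; every further vertex on the path lies in S).
data Reach (S : List ℕ) (nbr : ℕ → List ℕ) (u : ℕ) : ℕ → Set where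
  here : Reach S nbr u u
  step : ∀ {x w} → Reach S nbr u x → x ∈ S → w ∈ nbr x → w ∈ S → Reach S nbr u w

InducedConnected : List ℕ → (ℕ → List ℕ) → Set
InducedConnected S nbr = ∀ u w → u ∈ S → w ∈ S → Reach S nbr u w

-- An input of the online dominating set problem: a finite, connected, simple,
-- undirected graph with vertex set (the elements of) 'order', listed in the
-- adversary's revelation order v_1, ..., v_n, such that every prefix
-- {v_1,...,v_i} induces a connected subgraph.
record Input : Set where
  field
    order    : List ℕ
    nbr      : ℕ → List ℕ
    nonempty : order ≢ []
    distinct : Unique order
    nbr-in   : ∀ v → v ∈ order → ∀ u → u ∈ nbr v → u ∈ order
    nbr-uniq : ∀ v → v ∈ order → Unique (nbr v)
    loopless : ∀ v → v ∈ order → v ∉ nbr v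
    symm     : ∀ u v → v ∈ order → u ∈ nbr v → v ∈ nbr u
    prefix-connected : ∀ i → i ≤ length order → InducedConnected (take i order) nbr

open Input public

Bounded : ℕ → Input → Set
Bounded Δ I = ∀ v → v ∈ order I → length (nbr I v) ≤ Δ

Dominating : Input → List ℕ → Set
Dominating I D =
  (∀ u → u ∈ D → u ∈ order I) ×
  (∀ v → v ∈ order I → v ∈ D ⊎ (∃[ u ] (u ∈ nbr I v × u ∈ D)))

IsOPT : Input → ℕ → Set
IsOPT I k =
  (∃[ D ] (Unique D × Dominating I D × length D ≡ k)) ×
  (∀ D → Unique D → Dominating I D → k ≤ length D)

-- What the algorithm has seen after i steps: for each revealed vertex v_j
-- (j ≤ i, in order) the vertex together with its neighbourhood
-- (N[v_j] = v_j plus this list, including unrevealed neighbours).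
History : Set
History = List (ℕ × List ℕ)

-- A deterministic online algorithm: at step i it decides, as a function of
-- everything revealed so far (v_1,N[v_1]),...,(v_i,N[v_i]), whether to
-- select v_i. (Its own earlier decisions are functions of earlier histories.)
OnlineAlg : Set
OnlineAlg = History → Bool

reveal : (ℕ → List ℕ) → List ℕ → History
reveal nbr vs = map (λ v → (v , nbr v)) vs

run : OnlineAlg → (ℕ → List ℕ) → List ℕ → List ℕ → List ℕ
run A nbr pre [] = []
run A nbr pre (v ∷ vs) =
  if A (reveal nbr (pre ++ [ v ])) then v ∷ run A nbr (pre ++ [ v ]) vs
  else run A nbr (pre ++ [ v ]) vs

selected : OnlineAlg → Input → List ℕ
selected A I = run A (nbr I) [] (order I)

cost : OnlineAlg → Input → ℕ
cost A I = length (selected A I)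

Correct : ℕ → OnlineAlg → Set
Correct Δ A = ∀ I → Bounded Δ I → Dominating I (selected A I)

-- The adversary builds M blocks hanging off a path P 0 - ... - P (M-1). In block t the
-- algorithm first meets k vertices V t i, and its decision on V t i is taken before
-- anything depending on that decision has been revealed. If it selects V t i, the k
-- pendants Y t i j of V t i are later also joined to Z t, which dominates them anyway;
-- if it rejects V t i, the Y t i j stay leaves of V t i and must all be selected. So the
-- algorithm pays 1 per selected and k per rejected V t i, whereas {P t, Z t} together
-- with the rejected V t i form a minimum dominating set (a packing of equally many
-- disjoint closed neighbourhoods shows minimality). The maximum degree is k² + 2, and
-- per block (k + 2)(2 + #rejected) ≤ 4 (#selected + k · #rejected), so
-- ALG ≥ (k + 2)/4 · OPT > √Δ/4 · OPT.

module Submission where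

open import Defs
open import Data.Nat using (ℕ; zero; suc; _+_; _*_; _≤_; _<_; z≤n; s≤s; _<?_; _/_; _%_; NonZero; >-nonZero)
open import Data.Nat.Properties
open import Data.Nat.DivMod using (+-distrib-/-∣ʳ; [m+kn]%n≡m%n; m<n⇒m%n≡m; m<n⇒m/n≡0; m*n/n≡m)
open import Data.Nat.Divisibility using (n∣m*n)
open import Data.Nat.Induction using (<-rec)
open import Data.Nat.Tactic.RingSolver using (solve-∀)
open import Data.Bool using (Bool; true; false; if_then_else_)
import Data.Bool.Properties as Bool
open import Data.List using (List; []; _∷_; _++_; [_]; length; map; take; filter; upTo; concatMap; cartesianProductWith)
open import Data.List.Properties
  using (++-assoc; ++-identityʳ; length-++; length-map; length-upTo; length-filter; length-removeAt′;
         map-cong-local; filter-accept; filter-reject; filter-all; filter-none)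
open import Data.List.Membership.Propositional using (_∈_; _∉_; _─_; find; lose)
open import Data.List.Membership.Propositional.Properties
  using (∈-++⁺ˡ; ∈-++⁺ʳ; ∈-++⁻; ∈-map⁺; ∈-map⁻; ∈-upTo⁺; ∈-upTo⁻; ∈-filter⁺; ∈-filter⁻;
         ∈-concatMap⁺; ∈-concatMap⁻; ∈-cartesianProductWith⁺; ∈-cartesianProductWith⁻)
open import Data.List.Relation.Unary.Any using (here; there; index)
open import Data.List.Relation.Unary.All as All using (All; []; _∷_)
open import Data.List.Relation.Unary.All.Properties using (¬Any⇒All¬)
open import Data.List.Relation.Unary.AllPairs as AllPairs using (AllPairs; []; _∷_)
import Data.List.Relation.Unary.AllPairs.Properties as AllPairsₚ
open import Data.List.Relation.Unary.Unique.Propositional using (Unique)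
import Data.List.Relation.Unary.Unique.Propositional.Properties as Unique
open import Data.Product using (_×_; _,_; ∃-syntax; proj₁; proj₂)
open import Data.Sum using (_⊎_; inj₁; inj₂; swap)
open import Data.Empty using (⊥-elim)
open import Function using (case_of_)
open import Relation.Nullary using (¬_; yes; no; contradiction)
open import Relation.Nullary.Decidable using (_×-dec_)
open import Relation.Unary using (Decidable)
open import Relation.Binary.PropositionalEquality hiding ([_])

module _ {A : Set} where

  ∈-─⁺ : ∀ {xs} {x y : A} (x∈xs : x ∈ xs) → y ∈ xs → y ≢ x → y ∈ xs ─ x∈xs
  ∈-─⁺ (here refl) (here refl) y≢x = ⊥-elim (y≢x refl)
  ∈-─⁺ (here refl) (there y∈xs) _  = y∈xs
  ∈-─⁺ (there _)   (here refl)  _  = here refl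
  ∈-─⁺ (there x∈xs) (there y∈xs) y≢x = there (∈-─⁺ x∈xs y∈xs y≢x)

  ∷⁺ : ∀ {x : A} {xs} → x ∉ xs → Unique xs → Unique (x ∷ xs)
  ∷⁺ {xs = xs} x∉xs xs! = ¬Any⇒All¬ xs x∉xs ∷ xs!

module _ {A B : Set} where

  length-≤-injection : (R : A → B → Set) {xs : List A} {ys : List B} → Unique xs →
    (∀ {x} → x ∈ xs → ∃[ y ] (y ∈ ys × R x y)) →
    (∀ {x x′ y} → x ∈ xs → x′ ∈ xs → R x y → R x′ y → x ≡ x′) →
    length xs ≤ length ys
  length-≤-injection R {[]} _ _ _ = z≤n
  length-≤-injection R {x ∷ xs} {ys} (x∉xs ∷ xs!) witness injective
    with y , y∈ys , Rxy ← witness (here refl) =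
    subst (suc (length xs) ≤_) (sym (length-removeAt′ ys (index y∈ys)))
      (s≤s (length-≤-injection R xs! witness′ (λ p p′ → injective (there p) (there p′))))
    where
    witness′ : ∀ {x′} → x′ ∈ xs → ∃[ y′ ] (y′ ∈ ys ─ y∈ys × R x′ y′)
    witness′ x′∈xs with y′ , y′∈ys , Rx′y′ ← witness (there x′∈xs) =
      y′ , ∈-─⁺ y∈ys y′∈ys y′≢y , Rx′y′
      where
      y′≢y : y′ ≢ y
      y′≢y refl = All.lookup x∉xs x′∈xs (injective (here refl) (there x′∈xs) Rxy Rx′y′)

  Unique-map⁺ : (f : A → B) {xs : List A} →
    (∀ {x y} → x ∈ xs → y ∈ xs → f x ≡ f y → x ≡ y) → Unique xs → Unique (map f xs)
  Unique-map⁺ f _ [] = []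
  Unique-map⁺ f {x ∷ xs} injective (x∉xs ∷ xs!) =
    ∷⁺ fx∉ (Unique-map⁺ f (λ p q → injective (there p) (there q)) xs!)
    where
    fx∉ : f x ∉ map f xs
    fx∉ fx∈ with y , y∈xs , fx≡fy ← ∈-map⁻ f fx∈ =
      All.lookup x∉xs y∈xs (injective (here refl) (there y∈xs) fx≡fy)

  Unique-concatMap⁺ : (f : A → List B) (label : B → A) →
    (∀ x → Unique (f x)) → (∀ {x y} → y ∈ f x → label y ≡ x) →
    ∀ {xs} → Unique xs → Unique (concatMap f xs)
  Unique-concatMap⁺ f label f! labelled [] = []
  Unique-concatMap⁺ f label f! labelled {x ∷ xs} (x∉xs ∷ xs!) =
    Unique.++⁺ (f! x) (Unique-concatMap⁺ f label f! labelled xs!) disjoint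
    where
    disjoint : ∀ {y} → ¬ (y ∈ f x × y ∈ concatMap f xs)
    disjoint (y∈fx , y∈rest) with x′ , x′∈xs , y∈fx′ ← find (∈-concatMap⁻ f y∈rest) =
      All.lookup x∉xs x′∈xs (trans (sym (labelled y∈fx)) (labelled y∈fx′))

  length-concatMap-mono : (f g : A → List B) (m n : ℕ) →
    (∀ x → m * length (f x) ≤ n * length (g x)) →
    ∀ xs → m * length (concatMap f xs) ≤ n * length (concatMap g xs)
  length-concatMap-mono f g m n f≤g [] = ≤-reflexive (trans (*-zeroʳ m) (sym (*-zeroʳ n)))
  length-concatMap-mono f g m n f≤g (x ∷ xs)
    rewrite length-++ (f x) {concatMap f xs} | length-++ (g x) {concatMap g xs}
          | *-distribˡ-+ m (length (f x)) (length (concatMap f xs))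
          | *-distribˡ-+ n (length (g x)) (length (concatMap g xs)) =
    +-mono-≤ (f≤g x) (length-concatMap-mono f g m n f≤g xs)

  ≤-length-concatMap : (f : A → List B) → (∀ x → 1 ≤ length (f x)) →
    ∀ xs → length xs ≤ length (concatMap f xs)
  ≤-length-concatMap f nonempty [] = z≤n
  ≤-length-concatMap f nonempty (x ∷ xs) rewrite length-++ (f x) {concatMap f xs} =
    +-mono-≤ (nonempty x) (≤-length-concatMap f nonempty xs)

Unique-⊆⇒length-≤ : {A : Set} {xs ys : List A} → Unique xs → (∀ {x} → x ∈ xs → x ∈ ys) →
  length xs ≤ length ys
Unique-⊆⇒length-≤ xs! xs⊆ys =
  length-≤-injection (λ x y → y ≡ x) xs! (λ x∈ → _ , xs⊆ys x∈ , refl) λ _ _ → λ { refl refl → refl }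

module _ {A B C : Set} where

  length-cartesianProductWith : (f : A → B → C) (xs : List A) (ys : List B) →
    length (cartesianProductWith f xs ys) ≡ length xs * length ys
  length-cartesianProductWith f [] ys = refl
  length-cartesianProductWith f (x ∷ xs) ys = begin
    length (map (f x) ys ++ cartesianProductWith f xs ys)
      ≡⟨ length-++ (map (f x) ys) ⟩
    length (map (f x) ys) + length (cartesianProductWith f xs ys)
      ≡⟨ cong₂ _+_ (length-map (f x) ys) (length-cartesianProductWith f xs ys) ⟩
    length ys + length xs * length ys ∎
    where open ≡-Reasoning

length-filter-Bool : {A : Set} (f : A → Bool) (xs : List A) →
  length (filter (λ x → f x Bool.≟ true) xs) + length (filter (λ x → f x Bool.≟ false) xs) ≡ length xs
length-filter-Bool f [] = refl
length-filter-Bool f (x ∷ xs) with f x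
... | true  = cong suc (length-filter-Bool f xs)
... | false = trans (+-suc _ _) (cong suc (length-filter-Bool f xs))

∈-take⁻ : ∀ i {xs : List ℕ} {x} → x ∈ take i xs → x ∈ xs
∈-take⁻ (suc i) {_ ∷ _} (here refl) = here refl
∈-take⁻ (suc i) {_ ∷ _} (there x∈) = there (∈-take⁻ i x∈)

take-<-closed : ∀ {xs} → AllPairs _<_ xs → ∀ i {x y} → x ∈ take i xs → y ∈ xs → y < x → y ∈ take i xs
take-<-closed {_ ∷ _} _ (suc i) _ (here refl) _ = here refl
take-<-closed {_ ∷ _} (z< ∷ _) (suc i) (here refl) (there y∈) y<x =
  ⊥-elim (<-asym y<x (All.lookup z< y∈))
take-<-closed {_ ∷ _} (_ ∷ xs<) (suc i) (there x∈) (there y∈) y<x = there (take-<-closed xs< i x∈ y∈ y<x)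

increasing-split : ∀ {xs} → AllPairs _<_ xs → ∀ {x} → x ∈ xs →
  xs ≡ filter (_<? x) xs ++ x ∷ filter (x <?_) xs
increasing-split {_ ∷ xs} (x< ∷ _) {x} (here refl)
  rewrite filter-reject (_<? x) {x} {xs} (<-irrefl refl)
        | filter-reject (x <?_) {x} {xs} (<-irrefl refl)
        | filter-none (_<? x) (All.map (λ x<y y<x → <-asym x<y y<x) x<)
        | filter-all (x <?_) x< = refl
increasing-split {y ∷ xs} (y< ∷ xs<) {x} (there x∈)
  rewrite filter-accept (_<? x) {y} {xs} (All.lookup y< x∈)
        | filter-reject (x <?_) {y} {xs} (<-asym (All.lookup y< x∈)) = cong (y ∷_) (increasing-split xs< x∈)

-- Connectivity

module _ {S : List ℕ} {nbr : ℕ → List ℕ} where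

  Reach-trans : ∀ {u x w} → Reach S nbr u x → Reach S nbr x w → Reach S nbr u w
  Reach-trans p here = p
  Reach-trans p (step q x∈S w∈N w∈S) = step (Reach-trans p q) x∈S w∈N w∈S

  Reach-sym : (∀ {a b} → a ∈ S → b ∈ nbr a → a ∈ nbr b) → ∀ {u w} →
    Reach S nbr u w → Reach S nbr w u
  Reach-sym sym-S here = here
  Reach-sym sym-S (step {x} p x∈S w∈N w∈S) =
    Reach-trans (step here w∈S (sym-S x∈S w∈N) x∈S) (Reach-sym sym-S p)

-- A vertex reaches the root by repeatedly stepping to a smaller neighbour, and
-- a prefix of the increasing order contains all vertices smaller than its members.
increasing-prefixes-connected : (order : List ℕ) (nbr : ℕ → List ℕ) (root : ℕ) → AllPairs _<_ order →
  (∀ u v → v ∈ order → u ∈ nbr v → v ∈ nbr u) →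
  (∀ v → v ∈ order → ∀ u → u ∈ nbr v → u ∈ order) →
  (∀ v → v ∈ order → v ≡ root ⊎ ∃[ u ] (u ∈ nbr v × u < v)) →
  ∀ i → InducedConnected (take i order) nbr
increasing-prefixes-connected order nbr root increasing symm closed descent i u w u∈ w∈ =
  Reach-trans (Reach-sym sym-S (fromRoot u u∈)) (fromRoot w w∈)
  where
  S = take i order

  sym-S : ∀ {a b} → a ∈ S → b ∈ nbr a → a ∈ nbr b
  sym-S {a} {b} a∈ b∈N = symm b a (∈-take⁻ i a∈) b∈N

  fromRoot : ∀ v → v ∈ S → Reach S nbr root v
  fromRoot = <-rec (λ v → v ∈ S → Reach S nbr root v) go
    where
    go : ∀ v → (∀ {u} → u < v → u ∈ S → Reach S nbr root u) → v ∈ S → Reach S nbr root v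
    go v ih v∈S with descent v (∈-take⁻ i v∈S)
    ... | inj₁ refl = here
    ... | inj₂ (u , u∈N , u<v) =
      let v∈ = ∈-take⁻ i v∈S
          u∈S = take-<-closed increasing i v∈S (closed v v∈ u u∈N) u<v
      in step (ih u<v u∈S) u∈S (symm u v v∈ u∈N) v∈S

module _ (A : OnlineAlg) (nbr : ℕ → List ℕ) where

  run-++ : ∀ pre as bs → run A nbr pre (as ++ bs) ≡ run A nbr pre as ++ run A nbr (pre ++ as) bs
  run-++ pre [] bs = cong (λ p → run A nbr p bs) (sym (++-identityʳ pre))
  run-++ pre (a ∷ as) bs rewrite sym (++-assoc pre [ a ] as) with A (reveal nbr (pre ++ [ a ]))
  ... | true  = cong (a ∷_) (run-++ (pre ++ [ a ]) as bs)
  ... | false = run-++ (pre ++ [ a ]) as bs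

  run-⊆ : ∀ pre vs {x} → x ∈ run A nbr pre vs → x ∈ vs
  run-⊆ pre (v ∷ vs) x∈ with A (reveal nbr (pre ++ [ v ]))
  run-⊆ pre (v ∷ vs) (here refl) | true = here refl
  run-⊆ pre (v ∷ vs) (there x∈) | true = there (run-⊆ (pre ++ [ v ]) vs x∈)
  ... | false = there (run-⊆ (pre ++ [ v ]) vs x∈)

  ∈-run⁺ : ∀ pre as x cs → A (reveal nbr ((pre ++ as) ++ [ x ])) ≡ true →
    x ∈ run A nbr pre (as ++ x ∷ cs)
  ∈-run⁺ pre as x cs accept rewrite run-++ pre as (x ∷ cs) | accept =
    ∈-++⁺ʳ (run A nbr pre as) (here refl)

  ∉-run⁺ : ∀ pre as x cs → x ∉ as → x ∉ cs → A (reveal nbr ((pre ++ as) ++ [ x ])) ≡ false →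
    x ∉ run A nbr pre (as ++ x ∷ cs)
  ∉-run⁺ pre as x cs x∉as x∉cs reject x∈ rewrite run-++ pre as (x ∷ cs) | reject
    with ∈-++⁻ (run A nbr pre as) x∈
  ... | inj₁ x∈as = x∉as (run-⊆ pre as x∈as)
  ... | inj₂ x∈cs = x∉cs (run-⊆ ((pre ++ as) ++ [ x ]) cs x∈cs)

2≤n⇒n+2≤n*n : ∀ {n} → 2 ≤ n → n + 2 ≤ n * n
2≤n⇒n+2≤n*n {n} 2≤n = begin
  n + 2        ≤⟨ +-monoʳ-≤ n 2≤n ⟩
  n + n        ≡⟨ cong (n +_) (sym (+-identityʳ n)) ⟩
  2 * n        ≤⟨ *-monoˡ-≤ n 2≤n ⟩
  n * n        ∎
  where open ≤-Reasoning

block-ratio : ∀ {k s u} → 2 ≤ k → s + u ≡ k → (2 + k) * (2 + u) ≤ 4 * (s + u * k)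
block-ratio {suc (suc r)} {s} {u} (s≤s (s≤s z≤n)) s+u≡k = begin
  (4 + r) * (2 + u)                       ≤⟨ m≤m+n _ (r * (2 + 3 * u)) ⟩
  (4 + r) * (2 + u) + r * (2 + 3 * u)     ≡⟨ slack r u ⟩
  4 * (2 + r) + 4 * ((1 + r) * u)         ≡⟨ cong (λ n → 4 * n + 4 * ((1 + r) * u)) (sym s+u≡k) ⟩
  4 * (s + u) + 4 * ((1 + r) * u)         ≡⟨ regroup s u r ⟩
  4 * (s + u * (2 + r))                   ∎
  where
  open ≤-Reasoning
  slack : ∀ r u → (4 + r) * (2 + u) + r * (2 + 3 * u) ≡ 4 * (2 + r) + 4 * ((1 + r) * u)
  slack = solve-∀
  regroup : ∀ s u r → 4 * (s + u) + 4 * ((1 + r) * u) ≡ 4 * (s + u * (2 + r))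
  regroup = solve-∀

floor-sqrt : ∀ n → ∃[ s ] (s * s ≤ n × n < suc s * suc s)
floor-sqrt zero = 0 , z≤n , s≤s z≤n
floor-sqrt (suc n) with s , s²≤n , n<[1+s]² ← floor-sqrt n with suc n <? suc s * suc s
... | yes 1+n<[1+s]² = s , m≤n⇒m≤1+n s²≤n , 1+n<[1+s]²
... | no  1+n≮[1+s]² = suc s , ≮⇒≥ 1+n≮[1+s]² , ≤-<-trans n<[1+s]² (*-mono-< (n<1+n (suc s)) (n<1+n (suc s)))

sqrt-decomposition : ∀ {Δ} → 9 ≤ Δ → ∃[ k ] (2 ≤ k × 2 + k * k ≤ Δ × Δ < (2 + k) * (2 + k))
sqrt-decomposition {Δ} 9≤Δ with floor-sqrt Δ
... | 0 , _ , Δ<1 = ⊥-elim (<⇒≱ Δ<1 (≤-trans (s≤s z≤n) 9≤Δ))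
... | 1 , _ , Δ<4 = ⊥-elim (<⇒≱ Δ<4 (≤-trans (m≤m+n 4 5) 9≤Δ))
... | 2 , _ , Δ<9 = ⊥-elim (<⇒≱ Δ<9 9≤Δ)
... | suc (suc (suc r)) , s²≤Δ , Δ<[1+s]² =
  2 + r , s≤s (s≤s z≤n) , ≤-trans (≤-trans (m≤m+n _ (3 + 2 * r)) (≤-reflexive (square-step r))) s²≤Δ , Δ<[1+s]²
  where
  square-step : ∀ r → 2 + (2 + r) * (2 + r) + (3 + 2 * r) ≡ (3 + r) * (3 + r)
  square-step = solve-∀

<-of-squares : ∀ a b c d Δ → a * a * (d * d) < b * b * Δ → Δ < c * c → a * d < b * c
<-of-squares a b c d Δ a²d²<b²Δ Δ<c² with a * d <? b * c
... | yes ad<bc = ad<bc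
... | no  ad≮bc = ⊥-elim (<-irrefl refl (begin-strict
  a * a * (d * d)    <⟨ a²d²<b²Δ ⟩
  b * b * Δ          ≤⟨ *-monoʳ-≤ (b * b) (<⇒≤ Δ<c²) ⟩
  b * b * (c * c)    ≡⟨ square-product b c ⟩
  (b * c) * (b * c)  ≤⟨ *-mono-≤ bc≤ad bc≤ad ⟩
  (a * d) * (a * d)  ≡⟨ sym (square-product a d) ⟩
  a * a * (d * d)    ∎))
  where
  open ≤-Reasoning
  bc≤ad : b * c ≤ a * d
  bc≤ad = ≮⇒≥ ad≮bc
  square-product : ∀ m n → m * m * (n * n) ≡ (m * n) * (m * n)
  square-product = solve-∀

ratio-transfer : ∀ a b c d L X → 0 < L → a * d < b * c → c * L ≤ d * X → a * L < b * X
ratio-transfer a b c d L X 0<L ad<bc cL≤dX = *-cancelʳ-< d (a * L) (b * X) (begin-strict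
  a * L * d      ≡⟨ *-swapʳ a L d ⟩
  a * d * L      <⟨ *-monoˡ-< L {{>-nonZero 0<L}} ad<bc ⟩
  b * c * L      ≡⟨ *-assoc b c L ⟩
  b * (c * L)    ≤⟨ *-monoʳ-≤ b cL≤dX ⟩
  b * (d * X)    ≡⟨ *-assoc b d X ⟨
  b * d * X      ≡⟨ *-swapʳ b d X ⟩
  b * X * d      ∎)
  where
  open ≤-Reasoning
  *-swapʳ : ∀ m n o → m * n * o ≡ m * o * n
  *-swapʳ = solve-∀

-- Vertices and their codes

Digits : Set
Digits = ℕ × ℕ × ℕ × ℕ

module Numeral (B : ℕ) .{{_ : NonZero B}} where

  numeral : Digits → ℕ
  numeral (c , t , i , j) = j + (i + (t + c * B) * B) * B

  digits : ℕ → Digits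
  digits n = n / B / B / B , n / B / B % B , n / B % B , n % B

  %-digit : ∀ {r} q → r < B → (r + q * B) % B ≡ r
  %-digit {r} q r<B = trans ([m+kn]%n≡m%n r q B) (m<n⇒m%n≡m r<B)

  /-digit : ∀ {r} q → r < B → (r + q * B) / B ≡ q
  /-digit {r} q r<B = begin
    (r + q * B) / B     ≡⟨ +-distrib-/-∣ʳ r (n∣m*n q) ⟩
    r / B + q * B / B   ≡⟨ cong₂ _+_ (m<n⇒m/n≡0 r<B) (m*n/n≡m q B) ⟩
    q                   ∎
    where open ≡-Reasoning

  SmallDigits : Digits → Set
  SmallDigits (_ , t , i , j) = t < B × i < B × j < B

  digits-numeral : ∀ d → SmallDigits d → digits (numeral d) ≡ d
  digits-numeral (c , t , i , j) (t<B , i<B , j<B)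
    rewrite /-digit (i + (t + c * B) * B) j<B | %-digit (i + (t + c * B) * B) j<B
          | /-digit (t + c * B) i<B | %-digit (t + c * B) i<B
          | /-digit c t<B | %-digit c t<B = refl

  lex-< : ∀ {q q′} r r′ → q < q′ → r < B → r + q * B < r′ + q′ * B
  lex-< {q} {q′} r r′ q<q′ r<B = begin-strict
    r + q * B    <⟨ +-monoˡ-< (q * B) r<B ⟩
    B + q * B    ≡⟨⟩
    suc q * B    ≤⟨ *-monoˡ-≤ B q<q′ ⟩
    q′ * B       ≤⟨ m≤n+m (q′ * B) r′ ⟩
    r′ + q′ * B  ∎
    where open ≤-Reasoning

  numeral-<ᶜ : ∀ d d′ → proj₁ d < proj₁ d′ → SmallDigits d → numeral d < numeral d′
  numeral-<ᶜ (c , t , i , j) (c′ , t′ , i′ , j′) c<c′ (t<B , i<B , j<B) =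
    lex-< j j′ (lex-< i i′ (lex-< t t′ c<c′ t<B) i<B) j<B

  numeral-<ᵗ : ∀ c t t′ i i′ j j′ → t < t′ → i < B → j < B →
    numeral (c , t , i , j) < numeral (c , t′ , i′ , j′)
  numeral-<ᵗ c t t′ i i′ j j′ t<t′ i<B j<B =
    lex-< j j′ (lex-< i i′ (+-monoˡ-< (c * B) t<t′) i<B) j<B

  numeral-<ⁱ : ∀ c t i i′ j j′ → i < i′ → j < B →
    numeral (c , t , i , j) < numeral (c , t , i′ , j′)
  numeral-<ⁱ c t i i′ j j′ i<i′ j<B =
    lex-< j j′ (+-monoˡ-< ((t + c * B) * B) i<i′) j<B

data Vertex : Set where
  P Q Z W : ℕ → Vertex
  V : ℕ → ℕ → Vertex
  Y : ℕ → ℕ → ℕ → Vertex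

-- The tag is the most significant digit, so P and V (tag 0) are revealed before all
-- other vertices, in the order P 0, V 0 _, P 1, V 1 _, ...
code : Vertex → Digits
code (P t)     = 0 , t , 0 , 0
code (V t i)   = 0 , t , suc i , 0
code (Q t)     = 1 , t , 0 , 0
code (Z t)     = 2 , t , 0 , 0
code (W t)     = 3 , t , 0 , 0
code (Y t i j) = 4 , t , i , j

decode : Digits → Vertex
decode (0 , t , 0 , _)     = P t
decode (0 , t , suc i , _) = V t i
decode (1 , t , _ , _)     = Q t
decode (2 , t , _ , _)     = Z t
decode (3 , t , _ , _)     = W t
decode (_ , t , i , j)     = Y t i j

decode-code : ∀ x → decode (code x) ≡ x
decode-code (P t)     = refl
decode-code (V t i)   = refl
decode-code (Q t)     = refl
decode-code (Z t)     = refl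
decode-code (W t)     = refl
decode-code (Y t i j) = refl

tag : Vertex → ℕ
tag x = proj₁ (code x)

block : Vertex → ℕ
block x = proj₁ (proj₂ (code x))

tag<5 : ∀ x → tag x < 5
tag<5 (P _)     = s≤s z≤n
tag<5 (V _ _)   = s≤s z≤n
tag<5 (Q _)     = s≤s (s≤s z≤n)
tag<5 (Z _)     = s≤s (s≤s (s≤s z≤n))
tag<5 (W _)     = s≤s (s≤s (s≤s (s≤s z≤n)))
tag<5 (Y _ _ _) = ≤-refl

module Encoding (M k : ℕ) where

  InGraph : Vertex → Set
  InGraph (P t)     = t < M
  InGraph (Q t)     = t < M
  InGraph (Z t)     = t < M
  InGraph (W t)     = t < M
  InGraph (V t i)   = t < M × i < k
  InGraph (Y t i j) = t < M × i < k × j < k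

  inGraph? : Decidable InGraph
  inGraph? (P t)     = t <? M
  inGraph? (Q t)     = t <? M
  inGraph? (Z t)     = t <? M
  inGraph? (W t)     = t <? M
  inGraph? (V t i)   = (t <? M) ×-dec (i <? k)
  inGraph? (Y t i j) = (t <? M) ×-dec (i <? k) ×-dec (j <? k)

  B : ℕ
  B = suc (M + k)

  open Numeral B public

  <M⇒<B : ∀ {t} → t < M → t < B
  <M⇒<B t<M = <-≤-trans t<M (≤-trans (m≤m+n M k) (n≤1+n _))

  <k⇒<B : ∀ {i} → i < k → i < B
  <k⇒<B i<k = <-≤-trans i<k (≤-trans (m≤n+m k M) (n≤1+n _))

  0<B : 0 < B
  0<B = s≤s z≤n

  small : ∀ x → InGraph x → SmallDigits (code x)
  small (P t)     t<M                 = <M⇒<B t<M , 0<B , 0<B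
  small (Q t)     t<M                 = <M⇒<B t<M , 0<B , 0<B
  small (Z t)     t<M                 = <M⇒<B t<M , 0<B , 0<B
  small (W t)     t<M                 = <M⇒<B t<M , 0<B , 0<B
  small (V t i)   (t<M , i<k)         = <M⇒<B t<M , s≤s (≤-trans i<k (m≤n+m k M)) , 0<B
  small (Y t i j) (t<M , i<k , j<k)   = <M⇒<B t<M , <k⇒<B i<k , <k⇒<B j<k

  enc : Vertex → ℕ
  enc x = numeral (code x)

  dec : ℕ → Vertex
  dec n = decode (digits n)

  dec-enc : ∀ x → InGraph x → dec (enc x) ≡ x
  dec-enc x x∈ = trans (cong decode (digits-numeral (code x) (small x x∈))) (decode-code x)

  enc-injective : ∀ {x y} → InGraph x → InGraph y → enc x ≡ enc y → x ≡ y
  enc-injective {x} {y} x∈ y∈ eq = trans (sym (dec-enc x x∈)) (trans (cong dec eq) (dec-enc y y∈))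

  enc-<-tag : ∀ {x y} → InGraph x → tag x < tag y → enc x < enc y
  enc-<-tag {x} {y} x∈ lt = numeral-<ᶜ (code x) (code y) lt (small x x∈)

  Bound : ℕ
  Bound = numeral (5 , 0 , 0 , 0)

  enc<Bound : ∀ x → InGraph x → enc x < Bound
  enc<Bound x x∈ = numeral-<ᶜ (code x) (5 , 0 , 0 , 0) (tag<5 x) (small x x∈)

  IsCode : ℕ → Set
  IsCode n = InGraph (dec n) × enc (dec n) ≡ n

  isCode? : Decidable IsCode
  isCode? n = inGraph? (dec n) ×-dec (enc (dec n) ≟ n)

  revealOrder : List ℕ
  revealOrder = filter isCode? (upTo Bound)

  revealOrder-increasing : AllPairs _<_ revealOrder
  revealOrder-increasing = AllPairsₚ.filter⁺ isCode? (AllPairsₚ.applyUpTo⁺₁ (λ n → n) Bound (λ i<j _ → i<j))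

  ∈-revealOrder⁺ : ∀ x → InGraph x → enc x ∈ revealOrder
  ∈-revealOrder⁺ x x∈ = ∈-filter⁺ isCode? (∈-upTo⁺ (enc<Bound x x∈))
    (subst InGraph (sym (dec-enc x x∈)) x∈ , cong enc (dec-enc x x∈))

  ∈-revealOrder⁻ : ∀ {n} → n ∈ revealOrder → ∃[ x ] (InGraph x × n ≡ enc x)
  ∈-revealOrder⁻ {n} n∈ with x∈ , enc-dec ← proj₂ (∈-filter⁻ isCode? {xs = upTo Bound} n∈) =
    dec n , x∈ , sym enc-dec

  tag0-downClosed : ∀ {x y} → InGraph y → tag y ≡ 0 → enc x < enc y → tag x ≡ 0
  tag0-downClosed {x} {y} y∈ tag-y x<y =
    n≤0⇒n≡0 (subst (tag x ≤_) tag-y (≮⇒≥ (λ y<x → <-asym x<y (enc-<-tag {y} {x} y∈ y<x))))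

-- The adversarial graph

-- Block t of the graph: a spine vertex P t on the path P 0 - ... - P (M-1), with a
-- pendant Q t, a neighbour Z t with pendant W t, and k vertices V t i each with k
-- pendants Y t i j; if the algorithm selected V t i (β t i = true), the Y t i j are
-- also joined to Z t.
module Graph (M k : ℕ) (β : ℕ → ℕ → Bool) where
  open Encoding M k

  chosen : ℕ → List ℕ
  chosen t = filter (λ i → β t i Bool.≟ true) (upTo k)

  previous : ℕ → List Vertex
  previous zero    = []
  previous (suc t) = [ P t ]

  next : ℕ → List Vertex
  next t with suc t <? M
  ... | yes _ = [ P (suc t) ]
  ... | no  _ = []

  N : Vertex → List Vertex
  N (P t)     = Q t ∷ Z t ∷ map (V t) (upTo k) ++ previous t ++ next t
  N (Q t)     = [ P t ]
  N (Z t)     = P t ∷ W t ∷ cartesianProductWith (Y t) (chosen t) (upTo k)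
  N (W t)     = [ Z t ]
  N (V t i)   = P t ∷ map (Y t i) (upTo k)
  N (Y t i j) = V t i ∷ (if β t i then [ Z t ] else [])

  data Edge : Vertex → Vertex → Set where
    P→P : ∀ {t} → suc t < M → Edge (P t) (P (suc t))
    P→Q : ∀ {t} → Edge (P t) (Q t)
    P→Z : ∀ {t} → Edge (P t) (Z t)
    P→V : ∀ {t i} → i < k → Edge (P t) (V t i)
    Z→W : ∀ {t} → Edge (Z t) (W t)
    V→Y : ∀ {t i j} → j < k → Edge (V t i) (Y t i j)
    Z→Y : ∀ {t i j} → i < k → j < k → β t i ≡ true → Edge (Z t) (Y t i j)

  Adjacent : Vertex → Vertex → Set
  Adjacent x y = Edge x y ⊎ Edge y x

  ∈-chosen⁺ : ∀ {t i} → i < k → β t i ≡ true → i ∈ chosen t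
  ∈-chosen⁺ i<k chosen-i = ∈-filter⁺ (λ i → _ Bool.≟ true) (∈-upTo⁺ i<k) chosen-i

  ∈-chosen⁻ : ∀ {t i} → i ∈ chosen t → i < k × β t i ≡ true
  ∈-chosen⁻ i∈ with i∈upTo , chosen-i ← ∈-filter⁻ (λ i → _ Bool.≟ true) {xs = upTo k} i∈ =
    ∈-upTo⁻ i∈upTo , chosen-i

  Unique-chosen : ∀ t → Unique (chosen t)
  Unique-chosen t = Unique.filter⁺ (λ i → β t i Bool.≟ true) (Unique.upTo⁺ k)

  unchosen : ℕ → List ℕ
  unchosen t = filter (λ i → β t i Bool.≟ false) (upTo k)

  ∈-unchosen⁺ : ∀ {t i} → i < k → β t i ≡ false → i ∈ unchosen t
  ∈-unchosen⁺ i<k unchosen-i = ∈-filter⁺ (λ i → _ Bool.≟ false) (∈-upTo⁺ i<k) unchosen-i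

  ∈-unchosen⁻ : ∀ {t i} → i ∈ unchosen t → i < k × β t i ≡ false
  ∈-unchosen⁻ i∈ with i∈upTo , unchosen-i ← ∈-filter⁻ (λ i → _ Bool.≟ false) {xs = upTo k} i∈ =
    ∈-upTo⁻ i∈upTo , unchosen-i

  Unique-unchosen : ∀ t → Unique (unchosen t)
  Unique-unchosen t = Unique.filter⁺ (λ i → β t i Bool.≟ false) (Unique.upTo⁺ k)

  length-chosen+unchosen : ∀ t → length (chosen t) + length (unchosen t) ≡ k
  length-chosen+unchosen t = trans (length-filter-Bool (β t) (upTo k)) (length-upTo k)

  ∈-next⁺ : ∀ {t} → suc t < M → P (suc t) ∈ next t
  ∈-next⁺ {t} p with suc t <? M
  ... | yes _ = here refl
  ... | no ¬p = contradiction p ¬p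

  ∈-next⁻ : ∀ {t y} → y ∈ next t → suc t < M × y ≡ P (suc t)
  ∈-next⁻ {t} y∈ with suc t <? M
  ∈-next⁻ (here refl) | yes p = p , refl

  ∈N⁺ : ∀ {x y} → Adjacent x y → y ∈ N x
  ∈N⁺ (inj₁ (P→P {t} p))     = there (there (∈-++⁺ʳ (map (V t) (upTo k)) (∈-++⁺ʳ (previous t) (∈-next⁺ p))))
  ∈N⁺ (inj₁ P→Q)             = here refl
  ∈N⁺ (inj₁ P→Z)             = there (here refl)
  ∈N⁺ (inj₁ (P→V i<k))       = there (there (∈-++⁺ˡ (∈-map⁺ _ (∈-upTo⁺ i<k))))
  ∈N⁺ (inj₁ Z→W)             = there (here refl)
  ∈N⁺ (inj₁ (V→Y j<k))       = there (∈-map⁺ _ (∈-upTo⁺ j<k))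
  ∈N⁺ (inj₁ (Z→Y i<k j<k e)) = there (there (∈-cartesianProductWith⁺ _ (∈-chosen⁺ i<k e) (∈-upTo⁺ j<k)))
  ∈N⁺ (inj₂ (P→P {t} _))     = there (there (∈-++⁺ʳ (map (V (suc t)) (upTo k)) (here refl)))
  ∈N⁺ (inj₂ P→Q)             = here refl
  ∈N⁺ (inj₂ P→Z)             = here refl
  ∈N⁺ (inj₂ (P→V _))         = here refl
  ∈N⁺ (inj₂ Z→W)             = here refl
  ∈N⁺ (inj₂ (V→Y _))         = here refl
  ∈N⁺ (inj₂ (Z→Y _ _ e))     rewrite e = there (here refl)

  ∈N⁻ : ∀ {x y} → InGraph x → y ∈ N x → Adjacent x y
  ∈N⁻ {P t} _ (here refl)                = inj₁ P→Q
  ∈N⁻ {P t} _ (there (here refl))        = inj₁ P→Z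
  ∈N⁻ {P t} t<M (there (there y∈)) with ∈-++⁻ (map (V t) (upTo k)) y∈
  ... | inj₁ y∈V with i , i∈ , refl ← ∈-map⁻ (V t) y∈V = inj₁ (P→V (∈-upTo⁻ i∈))
  ... | inj₂ y∈spine with ∈-++⁻ (previous t) y∈spine
  ∈N⁻ {P (suc t)} t<M _ | inj₂ _ | inj₁ (here refl) = inj₂ (P→P t<M)
  ∈N⁻ {P t} t<M _ | inj₂ _ | inj₂ y∈next with p , refl ← ∈-next⁻ y∈next = inj₁ (P→P p)
  ∈N⁻ {Q t} _ (here refl)                = inj₂ P→Q
  ∈N⁻ {Z t} _ (here refl)                = inj₂ P→Z
  ∈N⁻ {Z t} _ (there (here refl))        = inj₁ Z→W
  ∈N⁻ {Z t} _ (there (there y∈))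
    with i , j , i∈ , j∈ , refl ← ∈-cartesianProductWith⁻ (Y t) (chosen t) (upTo k) y∈
    with i<k , e ← ∈-chosen⁻ i∈ = inj₁ (Z→Y i<k (∈-upTo⁻ j∈) e)
  ∈N⁻ {W t} _ (here refl)                = inj₂ Z→W
  ∈N⁻ {V t i} (_ , i<k) (here refl)      = inj₂ (P→V i<k)
  ∈N⁻ {V t i} _ (there y∈) with j , j∈ , refl ← ∈-map⁻ (Y t i) y∈ = inj₁ (V→Y (∈-upTo⁻ j∈))
  ∈N⁻ {Y t i j} (_ , _ , j<k) (here refl) = inj₂ (V→Y j<k)
  ∈N⁻ {Y t i j} (_ , i<k , j<k) (there y∈) with β t i in e
  ∈N⁻ {Y t i j} (_ , i<k , j<k) (there (here refl)) | true = inj₂ (Z→Y i<k j<k e)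

  N-symmetric : ∀ {x y} → InGraph x → y ∈ N x → x ∈ N y
  N-symmetric x∈ y∈ = ∈N⁺ (swap (∈N⁻ x∈ y∈))

  Edge-inGraphʳ : ∀ {x y} → Edge x y → InGraph x → InGraph y
  Edge-inGraphʳ (P→P p)         _                 = p
  Edge-inGraphʳ P→Q             t<M               = t<M
  Edge-inGraphʳ P→Z             t<M               = t<M
  Edge-inGraphʳ (P→V i<k)       t<M               = t<M , i<k
  Edge-inGraphʳ Z→W             t<M               = t<M
  Edge-inGraphʳ (V→Y j<k)       (t<M , i<k)       = t<M , i<k , j<k
  Edge-inGraphʳ (Z→Y i<k j<k _) t<M               = t<M , i<k , j<k

  Edge-inGraphˡ : ∀ {x y} → Edge x y → InGraph y → InGraph x
  Edge-inGraphˡ (P→P _)     st<M              = <-trans (n<1+n _) st<M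
  Edge-inGraphˡ P→Q         t<M               = t<M
  Edge-inGraphˡ P→Z         t<M               = t<M
  Edge-inGraphˡ (P→V _)     (t<M , _)         = t<M
  Edge-inGraphˡ Z→W         t<M               = t<M
  Edge-inGraphˡ (V→Y _)     (t<M , i<k , _)   = t<M , i<k
  Edge-inGraphˡ (Z→Y _ _ _) (t<M , _ , _)     = t<M

  N-closed : ∀ {x y} → InGraph x → y ∈ N x → InGraph y
  N-closed x∈ y∈ with ∈N⁻ x∈ y∈
  ... | inj₁ xy = Edge-inGraphʳ xy x∈
  ... | inj₂ yx = Edge-inGraphˡ yx x∈

  Edge-irrefl : ∀ {x} → ¬ Edge x x
  Edge-irrefl ()

  N-irreflexive : ∀ {x} → InGraph x → x ∉ N x
  N-irreflexive x∈ x∈N with ∈N⁻ x∈ x∈N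
  ... | inj₁ xx = Edge-irrefl xx
  ... | inj₂ xx = Edge-irrefl xx

  descent : ∀ x → InGraph x → x ≡ P 0 ⊎ ∃[ y ] (y ∈ N x × enc y < enc x)
  descent (P zero)    _   = inj₁ refl
  descent (P (suc t)) t<M = inj₂ (P t , ∈N⁺ (inj₂ (P→P t<M)) , numeral-<ᵗ 0 t (suc t) 0 0 0 0 (n<1+n t) 0<B 0<B)
  descent (Q t)       t<M = inj₂ (P t , here refl , enc-<-tag {P t} {Q t} t<M (s≤s z≤n))
  descent (Z t)       t<M = inj₂ (P t , here refl , enc-<-tag {P t} {Z t} t<M (s≤s z≤n))
  descent (W t)       t<M = inj₂ (Z t , here refl , enc-<-tag {Z t} {W t} t<M (s≤s (s≤s (s≤s z≤n))))
  descent (V t i)     _   = inj₂ (P t , here refl , numeral-<ⁱ 0 t 0 (suc i) 0 0 (s≤s z≤n) 0<B)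
  descent (Y t i j) (t<M , i<k , _) =
    inj₂ (V t i , here refl , enc-<-tag {V t i} {Y t i j} (t<M , i<k) (s≤s z≤n))

  Y-injective : ∀ {t i i′ j j′} → Y t i j ≡ Y t i′ j′ → i ≡ i′ × j ≡ j′
  Y-injective refl = refl , refl

  Unique-next : ∀ t → Unique (next t)
  Unique-next t with suc t <? M
  ... | yes _ = [] ∷ []
  ... | no  _ = []

  Unique-spine : ∀ t → Unique (previous t ++ next t)
  Unique-spine zero    = Unique-next zero
  Unique-spine (suc t) = ∷⁺ (λ P-t∈ → case ∈-next⁻ P-t∈ of λ { (_ , ()) }) (Unique-next (suc t))

  ∈-spine⁻ : ∀ {t y} → y ∈ previous t ++ next t → ∃[ s ] (y ≡ P s)
  ∈-spine⁻ {t} y∈ with ∈-++⁻ (previous t) y∈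
  ∈-spine⁻ {suc t} _ | inj₁ (here refl) = t , refl
  ... | inj₂ y∈next with _ , refl ← ∈-next⁻ y∈next = suc t , refl

  Unique-N : ∀ x → Unique (N x)
  Unique-N (P t) =
    ∷⁺ Q∉ (∷⁺ Z∉ (Unique.++⁺ (Unique.map⁺ (λ { refl → refl }) (Unique.upTo⁺ k)) (Unique-spine t) V∉spine))
    where
    rest-tag0 : ∀ {y} → y ∈ map (V t) (upTo k) ++ previous t ++ next t → tag y ≡ 0
    rest-tag0 y∈ with ∈-++⁻ (map (V t) (upTo k)) y∈
    ... | inj₁ y∈V with _ , _ , refl ← ∈-map⁻ (V t) y∈V = refl
    ... | inj₂ y∈spine with _ , refl ← ∈-spine⁻ y∈spine = refl
    Z∉ : Z t ∉ map (V t) (upTo k) ++ previous t ++ next t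
    Z∉ Z∈ with () ← rest-tag0 Z∈
    Q∉ : Q t ∉ Z t ∷ map (V t) (upTo k) ++ previous t ++ next t
    Q∉ (there Q∈) with () ← rest-tag0 Q∈
    V∉spine : ∀ {y} → ¬ (y ∈ map (V t) (upTo k) × y ∈ previous t ++ next t)
    V∉spine (y∈V , y∈spine) with _ , _ , refl ← ∈-map⁻ (V t) y∈V with _ , () ← ∈-spine⁻ y∈spine
  Unique-N (Q t) = [] ∷ []
  Unique-N (Z t) = ∷⁺ P∉ (∷⁺ W∉ Y!)
    where
    Y! : Unique (cartesianProductWith (Y t) (chosen t) (upTo k))
    Y! = Unique.cartesianProductWith⁺ (Y t) Y-injective (Unique-chosen t) (Unique.upTo⁺ k)
    W∉ : W t ∉ cartesianProductWith (Y t) (chosen t) (upTo k)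
    W∉ W∈ with _ , _ , _ , _ , () ← ∈-cartesianProductWith⁻ (Y t) (chosen t) (upTo k) W∈
    P∉ : P t ∉ W t ∷ cartesianProductWith (Y t) (chosen t) (upTo k)
    P∉ (there P∈) with _ , _ , _ , _ , () ← ∈-cartesianProductWith⁻ (Y t) (chosen t) (upTo k) P∈
  Unique-N (W t) = [] ∷ []
  Unique-N (V t i) = ∷⁺ P∉ (Unique.map⁺ (λ { refl → refl }) (Unique.upTo⁺ k))
    where
    P∉ : P t ∉ map (Y t i) (upTo k)
    P∉ P∈ with _ , _ , () ← ∈-map⁻ (Y t i) P∈
  Unique-N (Y t i j) with β t i
  ... | true  = ∷⁺ (λ { (here ()) }) ([] ∷ [])
  ... | false = [] ∷ []

  length-spine : ∀ t → length (previous t ++ next t) ≤ 2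
  length-spine t rewrite length-++ (previous t) {next t} = +-mono-≤ (previous≤1 t) next≤1
    where
    previous≤1 : ∀ t → length (previous t) ≤ 1
    previous≤1 zero    = z≤n
    previous≤1 (suc t) = ≤-refl
    next≤1 : length (next t) ≤ 1
    next≤1 with suc t <? M
    ... | yes _ = ≤-refl
    ... | no  _ = z≤n

  length-chosen : ∀ t → length (chosen t) ≤ k
  length-chosen t = ≤-trans (length-filter (λ i → β t i Bool.≟ true) (upTo k)) (≤-reflexive (length-upTo k))

  degree≤ : 2 ≤ k → ∀ x → length (N x) ≤ 2 + k * k
  degree≤ 2≤k (P t) = s≤s (s≤s (begin
    length (map (V t) (upTo k) ++ previous t ++ next t)
      ≡⟨ length-++ (map (V t) (upTo k)) ⟩
    length (map (V t) (upTo k)) + length (previous t ++ next t)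
      ≡⟨ cong (_+ length (previous t ++ next t)) (trans (length-map (V t) (upTo k)) (length-upTo k)) ⟩
    k + length (previous t ++ next t)
      ≤⟨ +-monoʳ-≤ k (length-spine t) ⟩
    k + 2
      ≤⟨ 2≤n⇒n+2≤n*n 2≤k ⟩
    k * k ∎))
    where open ≤-Reasoning
  degree≤ 2≤k (Q t) = s≤s z≤n
  degree≤ 2≤k (Z t) rewrite length-cartesianProductWith (Y t) (chosen t) (upTo k) | length-upTo k =
    s≤s (s≤s (*-monoˡ-≤ k (length-chosen t)))
  degree≤ 2≤k (W t) = s≤s z≤n
  degree≤ 2≤k (V t i) rewrite length-map (Y t i) (upTo k) | length-upTo k =
    s≤s (m≤n⇒m≤1+n (≤-trans (m≤m+n k 2) (2≤n⇒n+2≤n*n 2≤k)))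
  degree≤ 2≤k (Y t i j) with β t i
  ... | true  = s≤s (s≤s z≤n)
  ... | false = s≤s z≤n

N-tag0 : ∀ M k β β′ {x} → tag x ≡ 0 → Graph.N M k β x ≡ Graph.N M k β′ x
N-tag0 M k β β′ {P t}   _ = refl
N-tag0 M k β β′ {V t i} _ = refl

-- The input, an optimal solution and the cost of the algorithm

module Instance (M k : ℕ) (β : ℕ → ℕ → Bool) where
  open Encoding M k
  open Graph M k β

  nbrs : ℕ → List ℕ
  nbrs n = map enc (N (dec n))

  nbrs-enc : ∀ {x} → InGraph x → nbrs (enc x) ≡ map enc (N x)
  nbrs-enc {x} x∈ = cong (λ y → map enc (N y)) (dec-enc x x∈)

  ∈-nbrs⁺ : ∀ {x y} → InGraph x → y ∈ N x → enc y ∈ nbrs (enc x)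
  ∈-nbrs⁺ x∈ y∈ = subst (_ ∈_) (sym (nbrs-enc x∈)) (∈-map⁺ enc y∈)

  ∈-nbrs⁻ : ∀ {x u} → InGraph x → u ∈ nbrs (enc x) → ∃[ y ] (y ∈ N x × u ≡ enc y)
  ∈-nbrs⁻ x∈ u∈ = ∈-map⁻ enc (subst (_ ∈_) (nbrs-enc x∈) u∈)

  nbrs-closed : ∀ v → v ∈ revealOrder → ∀ u → u ∈ nbrs v → u ∈ revealOrder
  nbrs-closed v v∈ u u∈ with x , x∈ , refl ← ∈-revealOrder⁻ v∈ with y , y∈N , refl ← ∈-nbrs⁻ x∈ u∈ =
    ∈-revealOrder⁺ y (N-closed x∈ y∈N)

  nbrs-symmetric : ∀ u v → v ∈ revealOrder → u ∈ nbrs v → v ∈ nbrs u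
  nbrs-symmetric u v v∈ u∈ with x , x∈ , refl ← ∈-revealOrder⁻ v∈ with y , y∈N , refl ← ∈-nbrs⁻ x∈ u∈ =
    ∈-nbrs⁺ (N-closed x∈ y∈N) (N-symmetric x∈ y∈N)

  nbrs-unique : ∀ v → v ∈ revealOrder → Unique (nbrs v)
  nbrs-unique v v∈ with x , x∈ , refl ← ∈-revealOrder⁻ v∈ =
    subst Unique (sym (nbrs-enc x∈))
      (Unique-map⁺ enc (λ y∈ y′∈ → enc-injective (N-closed x∈ y∈) (N-closed x∈ y′∈)) (Unique-N x))

  nbrs-irreflexive : ∀ v → v ∈ revealOrder → v ∉ nbrs v
  nbrs-irreflexive v v∈ v∈nbrs with x , x∈ , refl ← ∈-revealOrder⁻ v∈ with y , y∈N , eq ← ∈-nbrs⁻ x∈ v∈nbrs =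
    N-irreflexive x∈ (subst (_∈ N x) (sym (enc-injective x∈ (N-closed x∈ y∈N) eq)) y∈N)

  nbrs-descent : ∀ v → v ∈ revealOrder → v ≡ enc (P 0) ⊎ ∃[ u ] (u ∈ nbrs v × u < v)
  nbrs-descent v v∈ with x , x∈ , refl ← ∈-revealOrder⁻ v∈ with descent x x∈
  ... | inj₁ refl = inj₁ refl
  ... | inj₂ (y , y∈N , y<x) = inj₂ (enc y , ∈-nbrs⁺ x∈ y∈N , y<x)

  input : 0 < M → Input
  input 0<M = record
    { order            = revealOrder
    ; nbr              = nbrs
    ; nonempty         = λ eq → case subst (enc (P 0) ∈_) eq (∈-revealOrder⁺ (P 0) 0<M) of λ ()
    ; distinct         = AllPairs.map <⇒≢ revealOrder-increasing
    ; nbr-in           = nbrs-closed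
    ; nbr-uniq         = nbrs-unique
    ; loopless         = nbrs-irreflexive
    ; symm             = nbrs-symmetric
    ; prefix-connected = λ i _ → increasing-prefixes-connected revealOrder nbrs (enc (P 0))
                           revealOrder-increasing nbrs-symmetric nbrs-closed nbrs-descent i
    }

  input-bounded : ∀ Δ (0<M : 0 < M) → 2 ≤ k → 2 + k * k ≤ Δ → Bounded Δ (input 0<M)
  input-bounded Δ 0<M 2≤k deg≤Δ v v∈ with x , x∈ , refl ← ∈-revealOrder⁻ v∈
    rewrite nbrs-enc x∈ | length-map enc (N x) = ≤-trans (degree≤ 2≤k x) deg≤Δ

  ∈-blocks⁺ : (f : ℕ → List Vertex) → ∀ {t y} → t < M → y ∈ f t → y ∈ concatMap f (upTo M)
  ∈-blocks⁺ f t<M y∈ = ∈-concatMap⁺ f (lose (∈-upTo⁺ t<M) y∈)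

  ∈-blocks⁻ : (f : ℕ → List Vertex) → ∀ {y} → y ∈ concatMap f (upTo M) → ∃[ t ] (t < M × y ∈ f t)
  ∈-blocks⁻ f y∈ with t , t∈ , y∈f ← find (∈-concatMap⁻ f y∈) = t , ∈-upTo⁻ t∈ , y∈f

  Dblock : ℕ → List Vertex
  Dblock t = P t ∷ Z t ∷ map (V t) (unchosen t)

  D : List Vertex
  D = concatMap Dblock (upTo M)

  M≤length-D : M ≤ length D
  M≤length-D = subst (_≤ length D) (length-upTo M) (≤-length-concatMap Dblock (λ _ → s≤s z≤n) (upTo M))

  data Dominator : Vertex → Set where
    P∈ : ∀ {t} → t < M → Dominator (P t)
    Z∈ : ∀ {t} → t < M → Dominator (Z t)
    V∈ : ∀ {t i} → t < M → i < k → β t i ≡ false → Dominator (V t i)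

  ∈-D⁻ : ∀ {d} → d ∈ D → Dominator d
  ∈-D⁻ d∈ with ∈-blocks⁻ Dblock d∈
  ... | t , t<M , here refl         = P∈ t<M
  ... | t , t<M , there (here refl) = Z∈ t<M
  ... | t , t<M , there (there d∈V) with i , i∈ , refl ← ∈-map⁻ (V t) d∈V
    with i<k , unchosen-i ← ∈-unchosen⁻ i∈ = V∈ t<M i<k unchosen-i

  Dominator-inGraph : ∀ {d} → Dominator d → InGraph d
  Dominator-inGraph (P∈ t<M)       = t<M
  Dominator-inGraph (Z∈ t<M)       = t<M
  Dominator-inGraph (V∈ t<M i<k _) = t<M , i<k

  D-dominates : ∀ x → InGraph x → x ∈ D ⊎ ∃[ y ] (y ∈ N x × y ∈ D)
  D-dominates (P t)     t<M = inj₁ (∈-blocks⁺ Dblock t<M (here refl))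
  D-dominates (Q t)     t<M = inj₂ (P t , here refl , ∈-blocks⁺ Dblock t<M (here refl))
  D-dominates (Z t)     t<M = inj₁ (∈-blocks⁺ Dblock t<M (there (here refl)))
  D-dominates (W t)     t<M = inj₂ (Z t , here refl , ∈-blocks⁺ Dblock t<M (there (here refl)))
  D-dominates (V t i)   (t<M , _) = inj₂ (P t , here refl , ∈-blocks⁺ Dblock t<M (here refl))
  D-dominates (Y t i j) (t<M , i<k , j<k) with β t i in e
  ... | true  = inj₂ (Z t , there (here refl) , ∈-blocks⁺ Dblock t<M (there (here refl)))
  ... | false = inj₂ (V t i , here refl ,
                      ∈-blocks⁺ Dblock t<M (there (there (∈-map⁺ (V t) (∈-unchosen⁺ i<k e)))))

  Unique-D : Unique D
  Unique-D = Unique-concatMap⁺ Dblock block Dblock-unique Dblock-labelled (Unique.upTo⁺ M)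
    where
    Dblock-unique : ∀ t → Unique (Dblock t)
    Dblock-unique t =
      ∷⁺ (λ { (here ()) ; (there Pt∈) → case ∈-map⁻ (V t) Pt∈ of λ { (_ , _ , ()) } })
        (∷⁺ (λ Zt∈ → case ∈-map⁻ (V t) Zt∈ of λ { (_ , _ , ()) })
          (Unique.map⁺ (λ { refl → refl }) (Unique-unchosen t)))
    Dblock-labelled : ∀ {t y} → y ∈ Dblock t → block y ≡ t
    Dblock-labelled (here refl)         = refl
    Dblock-labelled (there (here refl)) = refl
    Dblock-labelled {t} (there (there y∈)) with _ , _ , refl ← ∈-map⁻ (V t) y∈ = refl

  -- The closed neighbourhoods of the vertices own d (d ∈ D) are pairwise disjoint:
  -- own maps each of them back to its centre.
  own : Vertex → Vertex
  own (P t)     = Q t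
  own (Q t)     = Q t
  own (Z t)     = W t
  own (W t)     = W t
  own (V t i)   = Y t i 0
  own (Y t i j) = Y t i 0

  own-inGraph : 0 < k → ∀ {d} → Dominator d → InGraph (own d)
  own-inGraph 0<k (P∈ t<M)       = t<M
  own-inGraph 0<k (Z∈ t<M)       = t<M
  own-inGraph 0<k (V∈ t<M i<k _) = t<M , i<k , 0<k

  own-injective : ∀ {d d′} → Dominator d → Dominator d′ → own d ≡ own d′ → d ≡ d′
  own-injective (P∈ _)     (P∈ _)     refl = refl
  own-injective (P∈ _)     (Z∈ _)     ()
  own-injective (P∈ _)     (V∈ _ _ _) ()
  own-injective (Z∈ _)     (P∈ _)     ()
  own-injective (Z∈ _)     (Z∈ _)     refl = refl
  own-injective (Z∈ _)     (V∈ _ _ _) ()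
  own-injective (V∈ _ _ _) (P∈ _)     ()
  own-injective (V∈ _ _ _) (Z∈ _)     ()
  own-injective (V∈ _ _ _) (V∈ _ _ _) refl = refl

  own-closedNbhd : ∀ {d u} → Dominator d → u ≡ own d ⊎ u ∈ N (own d) → own u ≡ own d
  own-closedNbhd (P∈ _)     (inj₁ refl)        = refl
  own-closedNbhd (P∈ _)     (inj₂ (here refl)) = refl
  own-closedNbhd (Z∈ _)     (inj₁ refl)        = refl
  own-closedNbhd (Z∈ _)     (inj₂ (here refl)) = refl
  own-closedNbhd (V∈ _ _ _) (inj₁ refl)        = refl
  own-closedNbhd (V∈ _ _ _) (inj₂ (here refl)) = refl
  own-closedNbhd (V∈ _ _ unchosen-i) (inj₂ (there u∈)) rewrite unchosen-i with () ← u∈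

  module _ (0<M : 0 < M) where

    I : Input
    I = input 0<M

    D-dominating : Dominating I (map enc D)
    D-dominating = D⊆order , dominated
      where
      D⊆order : ∀ u → u ∈ map enc D → u ∈ revealOrder
      D⊆order u u∈ with d , d∈ , refl ← ∈-map⁻ enc u∈ =
        ∈-revealOrder⁺ d (Dominator-inGraph (∈-D⁻ d∈))
      dominated : ∀ v → v ∈ revealOrder → v ∈ map enc D ⊎ ∃[ u ] (u ∈ nbrs v × u ∈ map enc D)
      dominated v v∈ with x , x∈ , refl ← ∈-revealOrder⁻ v∈ with D-dominates x x∈
      ... | inj₁ x∈D = inj₁ (∈-map⁺ enc x∈D)
      ... | inj₂ (y , y∈N , y∈D) = inj₂ (enc y , ∈-nbrs⁺ x∈ y∈N , ∈-map⁺ enc y∈D)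

    D-minimum : 0 < k → ∀ D′ → Dominating I D′ → length D ≤ length D′
    D-minimum 0<k D′ (_ , dominated) = length-≤-injection ClosedNbhd Unique-D witness injective
      where
      ClosedNbhd : Vertex → ℕ → Set
      ClosedNbhd d b = b ≡ enc (own d) ⊎ b ∈ nbrs (enc (own d))

      witness : ∀ {d} → d ∈ D → ∃[ b ] (b ∈ D′ × ClosedNbhd d b)
      witness {d} d∈ with dominated (enc (own d)) (∈-revealOrder⁺ (own d) (own-inGraph 0<k (∈-D⁻ d∈)))
      ... | inj₁ b∈         = enc (own d) , b∈ , inj₁ refl
      ... | inj₂ (b , b∈N , b∈) = b , b∈ , inj₂ b∈N

      decode-ClosedNbhd : ∀ {d b} → Dominator d → ClosedNbhd d b →
        ∃[ u ] ((u ≡ own d ⊎ u ∈ N (own d)) × InGraph u × b ≡ enc u)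
      decode-ClosedNbhd {d} d∈ (inj₁ refl) = own d , inj₁ refl , own-inGraph 0<k d∈ , refl
      decode-ClosedNbhd {d} d∈ (inj₂ b∈N) with u , u∈N , refl ← ∈-nbrs⁻ (own-inGraph 0<k d∈) b∈N =
        u , inj₂ u∈N , N-closed (own-inGraph 0<k d∈) u∈N , refl

      injective : ∀ {d d′ b} → d ∈ D → d′ ∈ D → ClosedNbhd d b → ClosedNbhd d′ b → d ≡ d′
      injective d∈ d′∈ b∈ b∈′
        with u , u∈ , u-in , refl ← decode-ClosedNbhd (∈-D⁻ d∈) b∈
           | u′ , u′∈ , u′-in , eq ← decode-ClosedNbhd (∈-D⁻ d′∈) b∈′
        with refl ← enc-injective u-in u′-in eq =
        own-injective (∈-D⁻ d∈) (∈-D⁻ d′∈)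
          (trans (sym (own-closedNbhd (∈-D⁻ d∈) u∈)) (own-closedNbhd (∈-D⁻ d′∈) u′∈))

    D-optimal : 0 < k → IsOPT I (length D)
    D-optimal 0<k =
      (map enc D ,
       Unique-map⁺ enc (λ d∈ d′∈ → enc-injective (Dominator-inGraph (∈-D⁻ d∈)) (Dominator-inGraph (∈-D⁻ d′∈)))
         Unique-D ,
       D-dominating , length-map enc D) ,
      λ D′ _ → D-minimum 0<k D′

  Cblock : ℕ → List Vertex
  Cblock t = map (V t) (chosen t) ++ cartesianProductWith (Y t) (unchosen t) (upTo k)

  C : List Vertex
  C = concatMap Cblock (upTo M)

  data Costly : Vertex → Set where
    selectedV : ∀ {t i} → t < M → i < k → β t i ≡ true → Costly (V t i)
    forcedY   : ∀ {t i j} → t < M → i < k → j < k → β t i ≡ false → Costly (Y t i j)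

  ∈-C⁻ : ∀ {c} → c ∈ C → Costly c
  ∈-C⁻ c∈ with t , t<M , c∈C ← ∈-blocks⁻ Cblock c∈ with ∈-++⁻ (map (V t) (chosen t)) c∈C
  ... | inj₁ c∈V with i , i∈ , refl ← ∈-map⁻ (V t) c∈V with i<k , chosen-i ← ∈-chosen⁻ i∈ =
    selectedV t<M i<k chosen-i
  ... | inj₂ c∈Y with i , j , i∈ , j∈ , refl ← ∈-cartesianProductWith⁻ (Y t) (unchosen t) (upTo k) c∈Y
    with i<k , unchosen-i ← ∈-unchosen⁻ i∈ = forcedY t<M i<k (∈-upTo⁻ j∈) unchosen-i

  Costly-inGraph : ∀ {c} → Costly c → InGraph c
  Costly-inGraph (selectedV t<M i<k _)   = t<M , i<k
  Costly-inGraph (forcedY t<M i<k j<k _) = t<M , i<k , j<k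

  Unique-C : Unique C
  Unique-C = Unique-concatMap⁺ Cblock block Cblock-unique Cblock-labelled (Unique.upTo⁺ M)
    where
    Cblock-unique : ∀ t → Unique (Cblock t)
    Cblock-unique t = Unique.++⁺
      (Unique.map⁺ (λ { refl → refl }) (Unique-chosen t))
      (Unique.cartesianProductWith⁺ (Y t) Y-injective (Unique-unchosen t) (Unique.upTo⁺ k))
      λ (y∈V , y∈Y) → case ∈-map⁻ (V t) y∈V of λ where
        (_ , _ , refl) → case ∈-cartesianProductWith⁻ (Y t) (unchosen t) (upTo k) y∈Y of λ where
          (_ , _ , _ , _ , ())
    Cblock-labelled : ∀ {t y} → y ∈ Cblock t → block y ≡ t
    Cblock-labelled {t} y∈ with ∈-++⁻ (map (V t) (chosen t)) y∈
    ... | inj₁ y∈V with _ , _ , refl ← ∈-map⁻ (V t) y∈V = refl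
    ... | inj₂ y∈Y with _ , _ , _ , _ , refl ← ∈-cartesianProductWith⁻ (Y t) (unchosen t) (upTo k) y∈Y = refl

  D-C-ratio : 2 ≤ k → (2 + k) * length D ≤ 4 * length C
  D-C-ratio 2≤k = length-concatMap-mono Dblock Cblock (2 + k) 4 per-block (upTo M)
    where
    per-block : ∀ t → (2 + k) * length (Dblock t) ≤ 4 * length (Cblock t)
    per-block t
      rewrite length-map (V t) (unchosen t)
            | length-++ (map (V t) (chosen t)) {cartesianProductWith (Y t) (unchosen t) (upTo k)}
            | length-map (V t) (chosen t)
            | length-cartesianProductWith (Y t) (unchosen t) (upTo k)
            | length-upTo k = block-ratio 2≤k (length-chosen+unchosen t)

-- The adversary

module Adversary (M k : ℕ) (A : OnlineAlg) where
  open Encoding M k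

  -- The part of the graph revealed up to V t i does not depend on β (see N-tag0),
  -- so A's decision there can be computed with any choice of β.
  β : ℕ → ℕ → Bool
  β t i = A (reveal (Instance.nbrs M k (λ _ _ → false)) (filter (_<? enc (V t i)) revealOrder ++ [ enc (V t i) ]))

  open Graph M k β
  open Instance M k β

  module _ (0<M : 0 < M) {t i} (t<M : t < M) (i<k : i < k) where

    before after : List ℕ
    before = filter (_<? enc (V t i)) revealOrder
    after  = filter (enc (V t i) <?_) revealOrder

    revealOrder-split : revealOrder ≡ before ++ enc (V t i) ∷ after
    revealOrder-split = increasing-split revealOrder-increasing (∈-revealOrder⁺ (V t i) (t<M , i<k))

    revealed-tag0 : ∀ {y} → y ∈ before ++ [ enc (V t i) ] → tag (dec y) ≡ 0
    revealed-tag0 y∈ with ∈-++⁻ before y∈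
    ... | inj₂ (here refl) = cong tag (dec-enc (V t i) (t<M , i<k))
    ... | inj₁ y∈before with y∈order , y<x ← ∈-filter⁻ (_<? enc (V t i)) {xs = revealOrder} y∈before
      with z , z∈ , refl ← ∈-revealOrder⁻ y∈order =
      trans (cong tag (dec-enc z z∈)) (tag0-downClosed {z} {V t i} (t<M , i<k) refl y<x)

    decision : A (reveal nbrs (before ++ [ enc (V t i) ])) ≡ β t i
    decision = cong A (map-cong-local (All.tabulate λ {y} y∈ →
      cong (λ ns → y , map enc ns) (N-tag0 M k β (λ _ _ → false) (revealed-tag0 y∈))))

    V-selected : β t i ≡ true → enc (V t i) ∈ selected A (I 0<M)
    V-selected chosen-i = subst (λ vs → enc (V t i) ∈ run A nbrs [] vs) (sym revealOrder-split)
      (∈-run⁺ A nbrs [] before (enc (V t i)) after (trans decision chosen-i))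

    V-unselected : β t i ≡ false → enc (V t i) ∉ selected A (I 0<M)
    V-unselected unchosen-i x∈ =
      ∉-run⁺ A nbrs [] before (enc (V t i)) after
        (λ x∈before → <-irrefl refl (proj₂ (∈-filter⁻ (_<? enc (V t i)) {xs = revealOrder} x∈before)))
        (λ x∈after → <-irrefl refl (proj₂ (∈-filter⁻ (enc (V t i) <?_) {xs = revealOrder} x∈after)))
        (trans decision unchosen-i)
        (subst (λ vs → enc (V t i) ∈ run A nbrs [] vs) revealOrder-split x∈)

  -- A Y t i j of an unselected V t i has no other neighbour, so A must select it.
  C-selected : ∀ (0<M : 0 < M) → Dominating (I 0<M) (selected A (I 0<M)) →
    ∀ {c} → c ∈ C → enc c ∈ selected A (I 0<M)
  C-selected 0<M dominating c∈ with ∈-C⁻ c∈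
  ... | selectedV t<M i<k chosen-i = V-selected 0<M t<M i<k chosen-i
  ... | forcedY {t} {i} {j} t<M i<k j<k unchosen-i
    with proj₂ dominating (enc (Y t i j)) (∈-revealOrder⁺ (Y t i j) (t<M , i<k , j<k))
  ... | inj₁ Y∈ = Y∈
  ... | inj₂ (u , u∈N , u∈) with ∈-nbrs⁻ {Y t i j} (t<M , i<k , j<k) u∈N
  ...   | _ , here refl , refl = ⊥-elim (V-unselected 0<M t<M i<k unchosen-i u∈)
  ...   | _ , there y∈ , refl rewrite unchosen-i with () ← y∈

  C≤cost : ∀ (0<M : 0 < M) → Dominating (I 0<M) (selected A (I 0<M)) → length C ≤ cost A (I 0<M)
  C≤cost 0<M dominating = subst (_≤ cost A (I 0<M)) (length-map enc C)
    (Unique-⊆⇒length-≤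
      (Unique-map⁺ enc (λ c∈ c′∈ → enc-injective (Costly-inGraph (∈-C⁻ c∈)) (Costly-inGraph (∈-C⁻ c′∈))) Unique-C)
      λ u∈ → case ∈-map⁻ enc u∈ of λ where (c , c∈ , refl) → C-selected 0<M dominating c∈)

adversary : ∀ (A : OnlineAlg) Δ k M → 2 ≤ k → 0 < M → 2 + k * k ≤ Δ → Correct Δ A →
  ∃[ I ] (Bounded Δ I × ∃[ opt ] (IsOPT I opt × M ≤ opt × (2 + k) * opt ≤ 4 * cost A I))
adversary A Δ k M 2≤k 0<M degree≤Δ correct =
  I 0<M , bounded , length D , D-optimal 0<M (<-≤-trans (s≤s z≤n) 2≤k) , M≤length-D ,
  ≤-trans (D-C-ratio 2≤k) (*-monoʳ-≤ 4 (C≤cost 0<M (correct (I 0<M) bounded)))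
  where
  open Adversary M k A
  open Instance M k β
  bounded : Bounded Δ (I 0<M)
  bounded = input-bounded Δ 0<M 2≤k degree≤Δ

theorem6 : ∃[ d ] (1 ≤ d × ∃[ Δ₀ ] (∀ Δ → 2 ≤ Δ → Δ₀ ≤ Δ → ∀ (A : OnlineAlg) → Correct Δ A →
             ∀ a b → 1 ≤ b → (a * a) * (d * d) < (b * b) * Δ → ∀ N →
             ∃[ I ] (Bounded Δ I × ∃[ k ] (IsOPT I k × N ≤ k × a * k < b * cost A I))))
theorem6 = 4 , s≤s z≤n , 9 , bound
  where
  bound : ∀ Δ → 2 ≤ Δ → 9 ≤ Δ → ∀ (A : OnlineAlg) → Correct Δ A →
    ∀ a b → 1 ≤ b → (a * a) * (4 * 4) < (b * b) * Δ → ∀ N →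
    ∃[ I ] (Bounded Δ I × ∃[ k ] (IsOPT I k × N ≤ k × a * k < b * cost A I))
  bound Δ _ 9≤Δ A correct a b _ a²4²<b²Δ N
    with k , 2≤k , degree≤Δ , Δ<[2+k]² ← sqrt-decomposition 9≤Δ =
    conclude (adversary A Δ k (suc N) 2≤k (s≤s z≤n) degree≤Δ correct)
    where
    conclude : ∃[ I ] (Bounded Δ I × ∃[ opt ] (IsOPT I opt × suc N ≤ opt × (2 + k) * opt ≤ 4 * cost A I)) →
      ∃[ I ] (Bounded Δ I × ∃[ opt ] (IsOPT I opt × N ≤ opt × a * opt < b * cost A I))
    conclude (I , bounded , opt , optimal , 1+N≤opt , ratio) =
      I , bounded , opt , optimal , ≤-trans (n≤1+n N) 1+N≤opt ,
      ratio-transfer a b (2 + k) 4 opt (cost A I) (<-≤-trans (s≤s z≤n) 1+N≤opt)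
        (<-of-squares a b (2 + k) 4 Δ a²4²<b²Δ Δ<[2+k]²) ratio
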